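{- Let $\mathbf{C}$ be a locally small category, $\Omega$ an object, $\Phi\colon\mathbf{C}^{\mathrm{op}}\to\mathbf{Pos}$ a functor whose fibres have arbitrary meets preserved by all reindexing maps $f^*:=\Phi f$, and $d_\Omega\in\Phi\Omega$; let $\alpha_X,\gamma_X$ and $\mathrm{cl}_X=\gamma_X\circ\alpha_X$ be as in the context. Let $F\colon\mathbf{C}\to\mathbf{C}$ be a functor, $(\mathrm{ev}_\lambda\colon F\Omega\to\Omega)_{\lambda\in\Lambda}$ a family of morphisms with induced $\Lambda_X$, let $c\colon X\to FX$ be a coalgebra, $\Theta_X\subseteq\mathbf{C}(X,\Omega)$ a set of constants, and $\mathrm{cl}'_X$ a closure on $\mathcal{P}(\mathbf{C}(X,\Omega))$ that is compatible, i.e. $\Lambda_X(\mathrm{cl}'_X(\mathrm{cl}_X(S)))\subseteq\mathrm{cl}_{FX}(\Lambda_X(\mathrm{cl}'_X(S)))$ for all $S$. Define the logic function $\mathrm{lo}_X(S)=\mathcal{P}(c^\bullet)(\Lambda_X(\mathrm{cl}'_X(S)))\cup\Theta_X$. Then $\mathrm{lo}_X$ is $\mathrm{cl}_X$-compatible: $\mathrm{lo}_X(\mathrm{cl}_X(S))\subseteq\mathrm{cl}_X(\mathrm{lo}_X(S))$ for all $S\subseteq\mathbf{C}(X,\Omega)$.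
   Context: $\alpha_X\colon\mathcal{P}(\mathbf{C}(X,\Omega))\to\Phi X$, $\alpha_X(S)=\bigwedge_{k\in S}k^*(d_\Omega)$; $\gamma_X(d)=\{k\in\mathbf{C}(X,\Omega)\mid d\preceq k^*(d_\Omega)\}$. $\Lambda_X(S)=\{\mathrm{ev}_\lambda\circ Fh\mid\lambda\in\Lambda,h\in S\}\subseteq\mathbf{C}(FX,\Omega)$. A closure on a poset is a monotone, idempotent, extensive map (here on sets ordered by inclusion). For $g\colon A\to B$, $g^\bullet$ is precomposition with $g$ on morphisms into $\Omega$ and $\mathcal{P}(g^\bullet)$ its direct image; thus $\mathcal{P}(c^\bullet)$ maps subsets of $\mathbf{C}(FX,\Omega)$ to subsets of $\mathbf{C}(X,\Omega)$. -}

module Defs where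

open import Level using (Level; _⊔_) renaming (suc to lsuc)
open import Data.Product using (Σ; Σ-syntax; _×_)
open import Data.Sum using (_⊎_)
open import Relation.Binary.PropositionalEquality using (_≡_)
open import Relation.Binary.Structures using (IsPartialOrder)
open import Relation.Unary using (Pred; _⊆_; _∪_; _≐_)

record Category (o ℓ : Level) : Set (lsuc (o ⊔ ℓ)) where
  infixr 9 _∘_
  field
    Obj  : Set o
    Hom  : Obj → Obj → Set ℓ
    id   : ∀ {A} → Hom A A
    _∘_  : ∀ {A B C} → Hom B C → Hom A B → Hom A C
    identityˡ : ∀ {A B} {f : Hom A B} → id ∘ f ≡ f
    identityʳ : ∀ {A B} {f : Hom A B} → f ∘ id ≡ f
    assoc     : ∀ {A B C D} {f : Hom A B} {g : Hom B C} {h : Hom C D} →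
                (h ∘ g) ∘ f ≡ h ∘ (g ∘ f)

record Endofunctor {o ℓ} (C : Category o ℓ) : Set (o ⊔ ℓ) where
  open Category C
  field
    F₀ : Obj → Obj
    F₁ : ∀ {A B} → Hom A B → Hom (F₀ A) (F₀ B)
    F-id : ∀ {A} → F₁ (id {A}) ≡ id
    F-∘  : ∀ {A B D} {f : Hom A B} {g : Hom B D} → F₁ (g ∘ f) ≡ F₁ g ∘ F₁ f

record MeetFibration {o ℓ} (C : Category o ℓ) : Set (lsuc (o ⊔ ℓ)) where
  open Category C
  field
    Fib    : Obj → Set ℓ
    _≼_    : ∀ {X} → Fib X → Fib X → Set ℓ
    isPO   : ∀ {X} → IsPartialOrder (_≡_ {A = Fib X}) (_≼_ {X})
    reindex : ∀ {X Y} → Hom X Y → Fib Y → Fib X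
    reindex-mono : ∀ {X Y} (f : Hom X Y) {a b : Fib Y} → a ≼ b → reindex f a ≼ reindex f b
    reindex-id   : ∀ {X} (a : Fib X) → reindex id a ≡ a
    reindex-∘    : ∀ {X Y Z} (f : Hom X Y) (g : Hom Y Z) (a : Fib Z) →
                   reindex (g ∘ f) a ≡ reindex f (reindex g a)
    ⋀ : ∀ {X} → Pred (Fib X) ℓ → Fib X
    ⋀-lower    : ∀ {X} (T : Pred (Fib X) ℓ) {a} → T a → ⋀ T ≼ a
    ⋀-greatest : ∀ {X} (T : Pred (Fib X) ℓ) {b} → (∀ {a} → T a → b ≼ a) → b ≼ ⋀ T
    reindex-⋀ : ∀ {X Y} (f : Hom X Y) (T : Pred (Fib Y) ℓ) →
                reindex f (⋀ T) ≡ ⋀ (λ b → Σ[ a ∈ Fib Y ] (T a × b ≡ reindex f a))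

record IsClosure {ℓ} {A : Set ℓ} (cl : Pred A ℓ → Pred A ℓ) : Set (lsuc ℓ) where
  field
    monotone   : ∀ {S T : Pred A ℓ} → S ⊆ T → cl S ⊆ cl T
    idempotent : ∀ (S : Pred A ℓ) → cl (cl S) ≐ cl S
    extensive  : ∀ (S : Pred A ℓ) → S ⊆ cl S

module Logic {o ℓ} (C : Category o ℓ) (Φ : MeetFibration C)
             (Ω : Category.Obj C) (dΩ : MeetFibration.Fib Φ Ω) where
  open Category C
  open MeetFibration Φ

  α : ∀ {X} → Pred (Hom X Ω) ℓ → Fib X
  α S = ⋀ (λ d → Σ[ k ∈ Hom _ Ω ] (S k × d ≡ reindex k dΩ))

  γ : ∀ {X} → Fib X → Pred (Hom X Ω) ℓ
  γ d k = d ≼ reindex k dΩ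

  cl : ∀ {X} → Pred (Hom X Ω) ℓ → Pred (Hom X Ω) ℓ
  cl S = γ (α S)

  P• : ∀ {A B} → Hom A B → Pred (Hom B Ω) ℓ → Pred (Hom A Ω) ℓ
  P• g T k = Σ[ h ∈ Hom _ Ω ] (T h × k ≡ h ∘ g)

  module _ (F : Endofunctor C) (Λ : Set ℓ) (ev : Λ → Hom (Endofunctor.F₀ F Ω) Ω) where
    open Endofunctor F

    ΛX : ∀ {X} → Pred (Hom X Ω) ℓ → Pred (Hom (F₀ X) Ω) ℓ
    ΛX S g = Σ[ l ∈ Λ ] Σ[ h ∈ Hom _ Ω ] (S h × g ≡ ev l ∘ F₁ h)

    lo : ∀ {X} (c : Hom X (F₀ X)) (Θ : Pred (Hom X Ω) ℓ)
         (cl′ : Pred (Hom X Ω) ℓ → Pred (Hom X Ω) ℓ) →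
         Pred (Hom X Ω) ℓ → Pred (Hom X Ω) ℓ
    lo c Θ cl′ S = P• c (ΛX (cl′ S)) ∪ Θ

module Submission where

open import Defs
open import Level using () renaming (suc to lsuc)
open import Data.Product using (_,_)
open import Data.Sum using (inj₁; inj₂)
open import Function using (_∘′_)
open import Relation.Binary.PropositionalEquality using (_≡_; refl; sym; trans; cong)
open import Relation.Binary.Structures using (IsPartialOrder)
open import Relation.Unary using (Pred; _⊆_; _∪_)

-- The closure cl = γ ∘ α is laxly natural for the direct image of
-- precomposition, because reindexing preserves meets; compatibility of
-- lo = P(c•) ∘ Λ ∘ cl′ ∪ Θ then follows by composing compatible operators.

module ClosureCompatibility {o ℓ} (C : Category o ℓ) (Φ : MeetFibration C)
                            (Ω : Category.Obj C) (dΩ : MeetFibration.Fib Φ Ω) where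
  open Category C
  open MeetFibration Φ
  open Logic C Φ Ω dΩ

  ≼-trans : ∀ {X} {a b c : Fib X} → a ≼ b → b ≼ c → a ≼ c
  ≼-trans = IsPartialOrder.trans isPO

  ≼-reflexive : ∀ {X} {a b : Fib X} → a ≡ b → a ≼ b
  ≼-reflexive = IsPartialOrder.reflexive isPO

  Compatible : ∀ {X Y} → (Pred (Hom X Ω) ℓ → Pred (Hom Y Ω) ℓ) → Set (lsuc ℓ)
  Compatible L = ∀ S → L (cl S) ⊆ cl (L S)

  cl-extensive : ∀ {X} (S : Pred (Hom X Ω) ℓ) → S ⊆ cl S
  cl-extensive S {k} Sk = ⋀-lower _ (k , Sk , refl)

  α-antitone : ∀ {X} {S T : Pred (Hom X Ω) ℓ} → S ⊆ T → α T ≼ α S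
  α-antitone S⊆T = ⋀-greatest _ λ { (k , Sk , eq) → ⋀-lower _ (k , S⊆T Sk , eq) }

  cl-monotone : ∀ {X} {S T : Pred (Hom X Ω) ℓ} → S ⊆ T → cl S ⊆ cl T
  cl-monotone S⊆T = ≼-trans (α-antitone S⊆T)

  α-P•-≼-reindex-α : ∀ {X Y} (g : Hom X Y) (U : Pred (Hom Y Ω) ℓ) →
                     α (P• g U) ≼ reindex g (α U)
  α-P•-≼-reindex-α g U = ≼-trans
    (⋀-greatest _ λ { (a , (h , Uh , a≡h*d) , b≡g*a) →
       ⋀-lower _ (h ∘ g , (h , Uh , refl) ,
         trans b≡g*a (trans (cong (reindex g) a≡h*d) (sym (reindex-∘ g h dΩ)))) })
    (≼-reflexive (sym (reindex-⋀ g _)))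

  P•-cl-⊆-cl-P• : ∀ {X Y} (g : Hom X Y) (U : Pred (Hom Y Ω) ℓ) →
                  P• g (cl U) ⊆ cl (P• g U)
  P•-cl-⊆-cl-P• g U (h , αU≼h*d , refl) =
    ≼-trans (α-P•-≼-reindex-α g U)
      (≼-trans (reindex-mono g αU≼h*d) (≼-reflexive (sym (reindex-∘ g h dΩ))))

  P•-compatible : ∀ {X Y Z} (g : Hom X Y) {L : Pred (Hom Z Ω) ℓ → Pred (Hom Y Ω) ℓ} →
                  Compatible L → Compatible (P• g ∘′ L)
  P•-compatible g {L} compat S (h , Lh , eq) =
    P•-cl-⊆-cl-P• g (L S) (h , compat S Lh , eq)

  ∪-constant-compatible : ∀ {X Y} (Θ : Pred (Hom Y Ω) ℓ)
                          {L : Pred (Hom X Ω) ℓ → Pred (Hom Y Ω) ℓ} →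
                          Compatible L → Compatible (λ S → L S ∪ Θ)
  ∪-constant-compatible Θ compat S (inj₁ Lk) = cl-monotone inj₁ (compat S Lk)
  ∪-constant-compatible Θ compat S (inj₂ θ)  = cl-extensive _ (inj₂ θ)

proposition3 : ∀ {o ℓ} (C : Category o ℓ) (Φ : MeetFibration C)
    (Ω : Category.Obj C) (dΩ : MeetFibration.Fib Φ Ω)
    (F : Endofunctor C) (Λ : Set ℓ)
    (ev : Λ → Category.Hom C (Endofunctor.F₀ F Ω) Ω)
    {X : Category.Obj C} (c : Category.Hom C X (Endofunctor.F₀ F X))
    (Θ : Pred (Category.Hom C X Ω) ℓ)
    (cl′ : Pred (Category.Hom C X Ω) ℓ → Pred (Category.Hom C X Ω) ℓ) →
    IsClosure cl′ →
    (∀ (S : Pred (Category.Hom C X Ω) ℓ) →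
      Logic.ΛX C Φ Ω dΩ F Λ ev (cl′ (Logic.cl C Φ Ω dΩ S))
        ⊆ Logic.cl C Φ Ω dΩ (Logic.ΛX C Φ Ω dΩ F Λ ev (cl′ S))) →
    ∀ (S : Pred (Category.Hom C X Ω) ℓ) →
      Logic.lo C Φ Ω dΩ F Λ ev c Θ cl′ (Logic.cl C Φ Ω dΩ S)
        ⊆ Logic.cl C Φ Ω dΩ (Logic.lo C Φ Ω dΩ F Λ ev c Θ cl′ S)
proposition3 C Φ Ω dΩ F Λ ev c Θ cl′ _ Λ∘cl′-compatible =
  ∪-constant-compatible Θ (P•-compatible c Λ∘cl′-compatible)
  where open ClosureCompatibility C Φ Ω dΩ
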